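{- The only integer triple $(2,4,c)$ with $c\ge3$, $c\ne4$, such that each of $(2,4,c)$, $(3,5,c+1)$ and $(4,6,c+2)$ is multiplicatively dependent, is $(2,4,14)$.
   Context: A tuple $(z_1,\dots,z_n)$ of positive integers is multiplicatively dependent if there exists a nonzero $(k_1,\dots,k_n)\in\mathbb{Z}^n$ with $z_1^{k_1}\cdots z_n^{k_n}=1$. -}

module Defs where

open import Data.Nat as ℕ using (ℕ; zero; suc)
open import Data.Integer as ℤ using (ℤ; +_; -[1+_])
open import Data.Rational as ℚ using (ℚ; 1ℚ; _*_; 1/_; Positive)
open import Data.Rational.Properties using (pos*pos⇒pos; pos⇒nonZero)
import Data.Nat.Coprimality as Cop
open import Data.Vec using (Vec; []; _∷_; zipWith; foldr)
open import Data.Product using (Σ; _×_)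
open import Relation.Binary.PropositionalEquality using (_≡_)
open import Relation.Nullary using (¬_)

powℚ : ℚ → ℕ → ℚ
powℚ q zero = 1ℚ
powℚ q (suc n) = q * powℚ q n

pos1+ : ℕ → ℚ
pos1+ m = ℚ.mkℚ (+ suc m) 0 (Cop.sym (Cop.1-coprimeTo (suc m)))

powPos : ∀ m k → Positive (powℚ (pos1+ m) k)
powPos m zero = _
powPos m (suc k) = pos*pos⇒pos (pos1+ m) {{ℚ.positive {pos1+ m} (ℚ.*<* (ℤ.+<+ (ℕ.s≤s ℕ.z≤n)))}} (powℚ (pos1+ m) k) {{powPos m k}}

-- integer power z^k of a positive integer z = 1 + m, computed in ℚ
zpow : ℕ → ℤ → ℚ
zpow m (+ k) = powℚ (pos1+ m) k
zpow m -[1+ k ] =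
  (1/ powℚ (pos1+ m) (suc k)) {{pos⇒nonZero (powℚ (pos1+ m) (suc k)) {{powPos m (suc k)}}}}

prodPow : ∀ {n} → (zs : Vec ℕ n) → Vec ℤ n → ℚ
prodPow [] [] = 1ℚ
prodPow (zero ∷ zs) (k ∷ ks) = ℚ.0ℚ  -- never used: tuples are of positive integers
prodPow (suc m ∷ zs) (k ∷ ks) = zpow m k * prodPow zs ks

data NonZeroVec : ∀ {n} → Vec ℤ n → Set where
  here  : ∀ {n k} {ks : Vec ℤ n} → ¬ (k ≡ + 0) → NonZeroVec (k ∷ ks)
  there : ∀ {n k} {ks : Vec ℤ n} → NonZeroVec ks → NonZeroVec (k ∷ ks)

MultDep : ∀ {n} → Vec ℕ n → Set
MultDep {n} zs = Σ (Vec ℤ n) λ ks → NonZeroVec ks × prodPow zs ks ≡ 1ℚ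

{-# OPTIONS --safe #-}
-- Splitting every exponent into its positive and negative part turns
-- multiplicative dependence into an equality of two power products in ℕ.
-- Since 3, 5 (resp. 4, 6) are multiplicatively independent, the exponent of
-- c + 1 (resp. c + 2) survives in such a relation, and comparing the parts
-- prime to 3 and 5 (resp. 2 and 3) gives c + 1 = 3^x 5^y and c + 2 = 2^u 3^v.
-- Congruences modulo 2, 3, 4, 9 and 7, 25 and 11 show that 3^x 5^y + 1 = 2^u 3^v
-- forces x, y ≤ 1, so c + 1 ∈ {1, 3, 5, 15}.
module Submission where

open import Defs
open import Data.Nat using (ℕ; _≤_; _+_)
open import Data.Vec using (_∷_; [])
open import Data.Product using (_×_)
open import Function.Bundles using (_⇔_)
open import Relation.Binary.PropositionalEquality using (_≡_)
open import Relation.Nullary using (¬_)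

open import Algebra.Bundles using (CommutativeMonoid)
open import Data.Integer.Base using (ℤ; +_; -[1+_])
import Data.Integer.Base as ℤ
import Data.Integer.Properties as ℤ
open import Data.Nat.Base
import Data.Nat.Coprimality as Coprime
open import Data.Nat.Divisibility
open import Data.Nat.DivMod
open import Data.Nat.Induction using (<-wellFounded)
open import Data.Nat.Primality
  using (Prime; prime?; prime[2]; ¬prime[1]; euclidsLemma; prime⇒irreducible; prime⇒nonZero; prime⇒nonTrivial)
open import Data.Nat.Properties
open import Data.Nat.Tactic.RingSolver using (solve-∀)
open import Data.Product using (∃-syntax; ∃₂; _,_; map₁; proj₁; proj₂)
open import Data.Rational.Base using (ℚ; 1ℚ; mkℚ; ↥_)
import Data.Rational.Base as ℚ
import Data.Rational.Properties as ℚ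
import Data.Rational.Unnormalised.Base as ℚᵘ
import Data.Rational.Unnormalised.Properties as ℚᵘ
open import Data.Sum using ([_,_]; inj₁; inj₂)
open import Data.Vec using (Vec; map)
open import Data.Vec.Properties using (∷-injectiveˡ; ∷-injectiveʳ)
open import Function.Bundles using (mk⇔)
open import Induction.WellFounded using (Acc; acc)
open import Relation.Binary.Definitions using (tri<; tri≈; tri>)
open import Relation.Binary.PropositionalEquality
  using (_≢_; refl; sym; trans; cong; cong₂; subst; module ≡-Reasoning)
open import Relation.Nullary using (yes; no; ¬?; contradiction)
open import Relation.Nullary.Decidable using (True; toWitness; from-yes; from-no; _→-dec_)
open import Relation.Unary using (Decidable)
open import Algebra.Properties.CommutativeSemigroup
  (CommutativeMonoid.commutativeSemigroup ℚ.*-1-commutativeMonoid) using (interchange)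

-- Multiplicative dependence as a collision of power products in ℕ

fromℕ : ℕ → ℚ
fromℕ n = mkℚ (+ n) 0 (Coprime.sym (Coprime.1-coprimeTo n))

fromℕ-injective : ∀ {m n} → fromℕ m ≡ fromℕ n → m ≡ n
fromℕ-injective eq = ℤ.+-injective (cong ↥_ eq)

fromℕ-homo-* : ∀ m n → fromℕ (m * n) ≡ fromℕ m ℚ.* fromℕ n
fromℕ-homo-* m n = ℚ.toℚᵘ-injective (ℚᵘ.≃-trans
  (ℚᵘ.*≡* (cong (ℤ._* + 1) (ℤ.pos-* m n))) (ℚᵘ.≃-sym (ℚ.toℚᵘ-homo-* (fromℕ m) (fromℕ n))))

powℚ-pos1+ : ∀ m k → powℚ (pos1+ m) k ≡ fromℕ (suc m ^ k)
powℚ-pos1+ m zero    = refl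
powℚ-pos1+ m (suc k) = begin
  pos1+ m ℚ.* powℚ (pos1+ m) k         ≡⟨ cong (pos1+ m ℚ.*_) (powℚ-pos1+ m k) ⟩
  fromℕ (suc m) ℚ.* fromℕ (suc m ^ k)  ≡⟨ fromℕ-homo-* (suc m) (suc m ^ k) ⟨
  fromℕ (suc m ^ suc k)                ∎
  where open ≡-Reasoning

posPart negPart : ℤ → ℕ
posPart (+ n)    = n
posPart -[1+ n ] = 0
negPart (+ n)    = 0
negPart -[1+ n ] = suc n

posPart≡negPart⇒≡0 : ∀ k → posPart k ≡ negPart k → k ≡ + 0
posPart≡negPart⇒≡0 (+ zero) _ = refl

zpow-*-negPart : ∀ m k → zpow m k ℚ.* fromℕ (suc m ^ negPart k) ≡ fromℕ (suc m ^ posPart k)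
zpow-*-negPart m (+ n)    = trans (ℚ.*-identityʳ (powℚ (pos1+ m) n)) (powℚ-pos1+ m n)
zpow-*-negPart m -[1+ n ] = begin
  ℚ.1/ z^n ℚ.* fromℕ (suc m ^ suc n)  ≡⟨ cong (ℚ.1/ z^n ℚ.*_) (powℚ-pos1+ m (suc n)) ⟨
  ℚ.1/ z^n ℚ.* z^n                    ≡⟨ ℚ.*-inverseˡ z^n ⟩
  1ℚ                                  ∎
  where
  open ≡-Reasoning
  z^n = powℚ (pos1+ m) (suc n)
  instance _ = ℚ.pos⇒nonZero z^n {{powPos m (suc n)}}

powProd : ∀ {n} → Vec ℕ n → Vec ℕ n → ℕ
powProd []       []       = 1
powProd (z ∷ zs) (e ∷ es) = z ^ e * powProd zs es

prodPow-*-negParts : ∀ {n} (ms : Vec ℕ n) ks →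
  prodPow (map suc ms) ks ℚ.* fromℕ (powProd (map suc ms) (map negPart ks))
    ≡ fromℕ (powProd (map suc ms) (map posPart ks))
prodPow-*-negParts []       []       = ℚ.*-identityˡ 1ℚ
prodPow-*-negParts (m ∷ ms) (k ∷ ks) = begin
  (z^k ℚ.* P) ℚ.* fromℕ (z^k⁻ * N)         ≡⟨ cong (z^k ℚ.* P ℚ.*_) (fromℕ-homo-* z^k⁻ N) ⟩
  (z^k ℚ.* P) ℚ.* (fromℕ z^k⁻ ℚ.* fromℕ N) ≡⟨ interchange z^k P (fromℕ z^k⁻) (fromℕ N) ⟩
  (z^k ℚ.* fromℕ z^k⁻) ℚ.* (P ℚ.* fromℕ N) ≡⟨ cong₂ ℚ._*_ (zpow-*-negPart m k) (prodPow-*-negParts ms ks) ⟩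
  fromℕ z^k⁺ ℚ.* fromℕ Pos                 ≡⟨ fromℕ-homo-* z^k⁺ Pos ⟨
  fromℕ (z^k⁺ * Pos)                       ∎
  where
  open ≡-Reasoning
  z^k  = zpow m k
  z^k⁻ = suc m ^ negPart k
  z^k⁺ = suc m ^ posPart k
  P    = prodPow (map suc ms) ks
  N    = powProd (map suc ms) (map negPart ks)
  Pos  = powProd (map suc ms) (map posPart ks)

MultDepℕ : ∀ {n} → Vec ℕ n → Set
MultDepℕ zs = ∃₂ λ es fs → es ≢ fs × powProd zs es ≡ powProd zs fs

posParts≢negParts : ∀ {n} {ks : Vec ℤ n} → NonZeroVec ks → map posPart ks ≢ map negPart ks
posParts≢negParts (here k≢0) eq = k≢0 (posPart≡negPart⇒≡0 _ (∷-injectiveˡ eq))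
posParts≢negParts (there nz) eq = posParts≢negParts nz (∷-injectiveʳ eq)

multDep⇒multDepℕ : ∀ {n} (ms : Vec ℕ n) → MultDep (map suc ms) → MultDepℕ (map suc ms)
multDep⇒multDepℕ ms (ks , nz , prod≡1) =
  map posPart ks , map negPart ks , posParts≢negParts nz , fromℕ-injective (begin
    fromℕ Pos             ≡⟨ prodPow-*-negParts ms ks ⟨
    prodPow zs ks ℚ.* N   ≡⟨ cong (ℚ._* N) prod≡1 ⟩
    1ℚ ℚ.* N              ≡⟨ ℚ.*-identityˡ N ⟩
    N                     ∎)
  where
  open ≡-Reasoning
  zs  = map suc ms
  Pos = powProd zs (map posPart ks)
  N   = fromℕ (powProd zs (map negPart ks))

^-distrib-* : ∀ m n k → (m * n) ^ k ≡ m ^ k * n ^ k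
^-distrib-* m n zero    = refl
^-distrib-* m n (suc k) = begin
  m * n * (m * n) ^ k     ≡⟨ cong (m * n *_) (^-distrib-* m n k) ⟩
  m * n * (m ^ k * n ^ k) ≡⟨ swap m n (m ^ k) (n ^ k) ⟩
  m * m ^ k * (n * n ^ k) ∎
  where
  open ≡-Reasoning
  swap : ∀ a b c d → a * b * (c * d) ≡ a * c * (b * d)
  swap = solve-∀

^-injectiveʳ : ∀ {m k l} → 1 < m → m ^ k ≡ m ^ l → k ≡ l
^-injectiveʳ {m} {k} {l} 1<m eq with <-cmp k l
... | tri< k<l _ _ = contradiction eq (<⇒≢ (^-monoʳ-< m 1<m k<l))
... | tri≈ _ k≡l _ = k≡l
... | tri> _ _ l<k = contradiction (sym eq) (<⇒≢ (^-monoʳ-< m 1<m l<k))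

^-collision⇒≤1 : ∀ {m k l} → k ≢ l → m ^ k ≡ m ^ l → m ≤ 1
^-collision⇒≤1 {zero}     _   _  = z≤n
^-collision⇒≤1 {suc zero} _   _  = ≤-refl
^-collision⇒≤1 {2+ _}     k≢l eq = contradiction (^-injectiveʳ (s≤s (s≤s z≤n)) eq) k≢l

collect-powers : ∀ p q r a b x y k →
  p ^ a * q ^ b * (p ^ x * (q ^ y * r)) ^ k ≡ p ^ (a + x * k) * (q ^ (b + y * k) * r ^ k)
collect-powers p q r a b x y k = begin
  p ^ a * q ^ b * (p ^ x * (q ^ y * r)) ^ k
    ≡⟨ cong (p ^ a * q ^ b *_) distribute ⟩
  p ^ a * q ^ b * (p ^ (x * k) * (q ^ (y * k) * r ^ k))
    ≡⟨ regroup (p ^ a) (q ^ b) (p ^ (x * k)) (q ^ (y * k)) (r ^ k) ⟩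
  p ^ a * p ^ (x * k) * (q ^ b * q ^ (y * k) * r ^ k)
    ≡⟨ cong₂ (λ u v → u * (v * r ^ k)) (^-distribˡ-+-* p a (x * k)) (^-distribˡ-+-* q b (y * k)) ⟨
  p ^ (a + x * k) * (q ^ (b + y * k) * r ^ k)
    ∎
  where
  open ≡-Reasoning
  regroup : ∀ a b c d e → a * b * (c * (d * e)) ≡ a * c * (b * d * e)
  regroup = solve-∀
  distribute : (p ^ x * (q ^ y * r)) ^ k ≡ p ^ (x * k) * (q ^ (y * k) * r ^ k)
  distribute = begin
    (p ^ x * (q ^ y * r)) ^ k           ≡⟨ ^-distrib-* (p ^ x) (q ^ y * r) k ⟩
    (p ^ x) ^ k * (q ^ y * r) ^ k       ≡⟨ cong ((p ^ x) ^ k *_) (^-distrib-* (q ^ y) r k) ⟩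
    (p ^ x) ^ k * ((q ^ y) ^ k * r ^ k)
      ≡⟨ cong₂ (λ u v → u * (v * r ^ k)) (^-*-assoc p x k) (^-*-assoc q y k) ⟩
    p ^ (x * k) * (q ^ (y * k) * r ^ k) ∎

∤⇒nonZero : ∀ {d n} → d ∤ n → NonZero n
∤⇒nonZero {d} {zero}  d∤0 = contradiction (d ∣0) d∤0
∤⇒nonZero {d} {suc _} _   = _

prime∤1 : ∀ {p} → Prime p → p ∤ 1
prime∤1 p-prime p∣1 = ¬prime[1] (subst Prime (∣1⇒≡1 p∣1) p-prime)

prime∤* : ∀ {p m n} → Prime p → p ∤ m → p ∤ n → p ∤ m * n
prime∤* {m = m} {n} p-prime p∤m p∤n p∣m*n = [ p∤m , p∤n ] (euclidsLemma m n p-prime p∣m*n)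

prime∤^ : ∀ {p m} → Prime p → p ∤ m → ∀ k → p ∤ m ^ k
prime∤^ p-prime p∤m zero    = prime∤1 p-prime
prime∤^ p-prime p∤m (suc k) = prime∤* p-prime p∤m (prime∤^ p-prime p∤m k)

prime∤^*^ : ∀ {p a b} → Prime p → p ∤ a → p ∤ b → ∀ i j → p ∤ a ^ i * b ^ j
prime∤^*^ p-prime p∤a p∤b i j = prime∤* p-prime (prime∤^ p-prime p∤a i) (prime∤^ p-prime p∤b j)

distinct-primes⇒∤ : ∀ {p q} → Prime p → Prime q → p ≢ q → p ∤ q
distinct-primes⇒∤ p-prime q-prime p≢q p∣q with prime⇒irreducible q-prime p∣q
... | inj₁ p≡1 = ¬prime[1] (subst Prime p≡1 p-prime)
... | inj₂ p≡q = p≢q p≡q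

^-*-cancel-∤ : ∀ p .{{_ : NonZero p}} {i j A B} → p ∤ A → p ∤ B →
               p ^ i * A ≡ p ^ j * B → i ≡ j × A ≡ B
^-*-cancel-∤ p {zero}  {zero}  {A} {B} _   _   eq =
  refl , trans (sym (*-identityˡ A)) (trans eq (*-identityˡ B))
^-*-cancel-∤ p {zero}  {suc j} {A} {B} p∤A _   eq =
  contradiction (subst (p ∣_) (trans (sym eq) (*-identityˡ A)) (∣m⇒∣m*n B (m∣m*n (p ^ j)))) p∤A
^-*-cancel-∤ p {suc i} {zero}  {A} {B} _   p∤B eq =
  contradiction (subst (p ∣_) (trans eq (*-identityˡ B)) (∣m⇒∣m*n A (m∣m*n (p ^ i)))) p∤B
^-*-cancel-∤ p {suc i} {suc j} {A} {B} p∤A p∤B eq =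
  map₁ (cong suc) (^-*-cancel-∤ p p∤A p∤B (*-cancelˡ-≡ (p ^ i * A) (p ^ j * B) p p*eq))
  where
  open ≡-Reasoning
  p*eq : p * (p ^ i * A) ≡ p * (p ^ j * B)
  p*eq = begin
    p * (p ^ i * A) ≡⟨ *-assoc p (p ^ i) A ⟨
    p * p ^ i * A   ≡⟨ eq ⟩
    p * p ^ j * B   ≡⟨ *-assoc p (p ^ j) B ⟩
    p * (p ^ j * B) ∎

p-free-part : ∀ p .{{_ : NonTrivial p}} m .{{_ : NonZero m}} → ∃₂ λ x r → p ∤ r × m ≡ p ^ x * r
p-free-part p m = go m (<-wellFounded m)
  where
  go : ∀ m .{{_ : NonZero m}} → Acc _<_ m → ∃₂ λ x r → p ∤ r × m ≡ p ^ x * r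
  go m (acc rec) with p ∣? m
  ... | no p∤m  = 0 , m , p∤m , sym (*-identityˡ m)
  ... | yes p∣m =
    let x , r , p∤r , quot≡p^x*r = go (quotient p∣m) {{quotient≢0 p∣m}} (rec (quotient-< p∣m))
    in  suc x , r , p∤r , (begin
          m                ≡⟨ m∣n⇒n≡m*quotient p∣m ⟩
          p * quotient p∣m ≡⟨ cong (p *_) quot≡p^x*r ⟩
          p * (p ^ x * r)  ≡⟨ *-assoc p (p ^ x) r ⟨
          p ^ suc x * r    ∎)
    where open ≡-Reasoning

-- Numbers whose prime factors lie in {p, q}

Smooth : ℕ → ℕ → ℕ → Set
Smooth p q n = ∃₂ λ x y → n ≡ p ^ x * q ^ y

Independent : ℕ → ℕ → Set
Independent a b =
  ∀ {e₁ e₂ f₁ f₂} → a ^ e₁ * b ^ e₂ ≡ a ^ f₁ * b ^ f₂ → e₁ ≡ f₁ × e₂ ≡ f₂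

powProd-triple : ∀ a b z e₁ e₂ k →
                 powProd (a ∷ b ∷ z ∷ []) (e₁ ∷ e₂ ∷ k ∷ []) ≡ a ^ e₁ * b ^ e₂ * z ^ k
powProd-triple a b z e₁ e₂ k = begin
  a ^ e₁ * (b ^ e₂ * (z ^ k * 1)) ≡⟨ cong (λ t → a ^ e₁ * (b ^ e₂ * t)) (*-identityʳ (z ^ k)) ⟩
  a ^ e₁ * (b ^ e₂ * z ^ k)       ≡⟨ *-assoc (a ^ e₁) (b ^ e₂) (z ^ k) ⟨
  a ^ e₁ * b ^ e₂ * z ^ k         ∎
  where open ≡-Reasoning

module PrimePair {p q} (p-prime : Prime p) (q-prime : Prime q) (p≢q : p ≢ q) where

  private instance
    p≢0 = prime⇒nonZero p-prime
    q≢0 = prime⇒nonZero q-prime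
    p>1 = prime⇒nonTrivial p-prime
    q>1 = prime⇒nonTrivial q-prime

  ^-*-^-*-cancel : ∀ {i j k l R S} → p ∤ R → p ∤ S → q ∤ R → q ∤ S →
                   p ^ i * (q ^ j * R) ≡ p ^ k * (q ^ l * S) → i ≡ k × j ≡ l × R ≡ S
  ^-*-^-*-cancel {j = j} {l = l} p∤R p∤S q∤R q∤S eq =
    let i≡k , q^j*R≡q^l*S = ^-*-cancel-∤ p (p∤q^*R j p∤R) (p∤q^*R l p∤S) eq
    in  i≡k , ^-*-cancel-∤ q q∤R q∤S q^j*R≡q^l*S
    where
    p∤q^*R : ∀ j {R} → p ∤ R → p ∤ q ^ j * R
    p∤q^*R j = prime∤* p-prime (prime∤^ p-prime (distinct-primes⇒∤ p-prime q-prime p≢q) j)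

  smooth-unique : Independent p q
  smooth-unique {i} {j} {k} {l} eq =
    let i≡k , j≡l , _ = ^-*-^-*-cancel p∤1 p∤1 q∤1 q∤1 (begin
          p ^ i * (q ^ j * 1) ≡⟨ cong (p ^ i *_) (*-identityʳ (q ^ j)) ⟩
          p ^ i * q ^ j       ≡⟨ eq ⟩
          p ^ k * q ^ l       ≡⟨ cong (p ^ k *_) (*-identityʳ (q ^ l)) ⟨
          p ^ k * (q ^ l * 1) ∎)
    in  i≡k , j≡l
    where
    open ≡-Reasoning
    p∤1 = prime∤1 p-prime
    q∤1 = prime∤1 q-prime

  decomposition : ∀ m .{{_ : NonZero m}} →
                  ∃[ x ] ∃[ y ] ∃[ r ] p ∤ r × q ∤ r × m ≡ p ^ x * (q ^ y * r)
  decomposition m =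
    let x , m′ , p∤m′ , m≡p^x*m′ = p-free-part p m
        y , r , q∤r , m′≡q^y*r = p-free-part q m′ {{∤⇒nonZero p∤m′}}
        p∤r = λ p∣r → p∤m′ (subst (p ∣_) (sym m′≡q^y*r) (∣n⇒∣m*n (q ^ y) p∣r))
    in  x , y , r , p∤r , q∤r , trans m≡p^x*m′ (cong (p ^ x *_) m′≡q^y*r)

  -- The part r of m prime to p and q satisfies r^k = r^l, hence r = 1.
  smooth-root : ∀ {A B k l} → Smooth p q A → Smooth p q B → ∀ m .{{_ : NonZero m}} →
                k ≢ l → A * m ^ k ≡ B * m ^ l → Smooth p q m
  smooth-root {A} {B} {k} {l} (a , b , A≡) (a′ , b′ , B≡) m k≢l eq with decomposition m
  ... | x , y , r , p∤r , q∤r , m≡ = x , y , (begin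
    m                   ≡⟨ m≡ ⟩
    p ^ x * (q ^ y * r) ≡⟨ cong (λ r → p ^ x * (q ^ y * r)) r≡1 ⟩
    p ^ x * (q ^ y * 1) ≡⟨ cong (p ^ x *_) (*-identityʳ (q ^ y)) ⟩
    p ^ x * q ^ y       ∎)
    where
    open ≡-Reasoning
    r^k≡r^l : r ^ k ≡ r ^ l
    r^k≡r^l = proj₂ (proj₂ (^-*-^-*-cancel {a + x * k} {b + y * k} {a′ + x * l} {b′ + y * l}
      (prime∤^ p-prime p∤r k) (prime∤^ p-prime p∤r l)
      (prime∤^ q-prime q∤r k) (prime∤^ q-prime q∤r l) (begin
        p ^ (a + x * k) * (q ^ (b + y * k) * r ^ k)     ≡⟨ collect-powers p q r a b x y k ⟨
        p ^ a * q ^ b * (p ^ x * (q ^ y * r)) ^ k       ≡⟨ cong₂ (λ n z → n * z ^ k) A≡ m≡ ⟨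
        A * m ^ k                                       ≡⟨ eq ⟩
        B * m ^ l                                       ≡⟨ cong₂ (λ n z → n * z ^ l) B≡ m≡ ⟩
        p ^ a′ * q ^ b′ * (p ^ x * (q ^ y * r)) ^ l     ≡⟨ collect-powers p q r a′ b′ x y l ⟩
        p ^ (a′ + x * l) * (q ^ (b′ + y * l) * r ^ l)   ∎)))
    r≡1 : r ≡ 1
    r≡1 = ≤-antisym (^-collision⇒≤1 k≢l r^k≡r^l) (>-nonZero⁻¹ r {{∤⇒nonZero p∤r}})

  smooth-of-multDepℕ : ∀ {a b} → Independent a b → (∀ e₁ e₂ → Smooth p q (a ^ e₁ * b ^ e₂)) →
                       ∀ z .{{_ : NonZero z}} → MultDepℕ (a ∷ b ∷ z ∷ []) → Smooth p q z
  smooth-of-multDepℕ {a} {b} indep smooth z (e₁ ∷ e₂ ∷ k ∷ [] , f₁ ∷ f₂ ∷ l ∷ [] , es≢fs , eq)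
    with k ≟ l
  ... | no k≢l   = smooth-root (smooth e₁ e₂) (smooth f₁ f₂) z k≢l
                     (trans (sym (powProd-triple a b z e₁ e₂ k)) (trans eq (powProd-triple a b z f₁ f₂ l)))
  ... | yes refl = contradiction (cong₂ (λ e f → e ∷ f ∷ k ∷ []) e₁≡f₁ e₂≡f₂) es≢fs
    where
    instance _ = m^n≢0 z k
    e₁≡f₁×e₂≡f₂ = indep (*-cancelʳ-≡ (a ^ e₁ * b ^ e₂) (a ^ f₁ * b ^ f₂) (z ^ k)
      (trans (sym (powProd-triple a b z e₁ e₂ k)) (trans eq (powProd-triple a b z f₁ f₂ k))))
    e₁≡f₁ = proj₁ e₁≡f₁×e₂≡f₂
    e₂≡f₂ = proj₂ e₁≡f₁×e₂≡f₂

prime[3] : Prime 3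
prime[3] = from-yes (prime? 3)

prime[5] : Prime 5
prime[5] = from-yes (prime? 5)

prime[7] : Prime 7
prime[7] = from-yes (prime? 7)

prime[11] : Prime 11
prime[11] = from-yes (prime? 11)

module Primes-3-5 = PrimePair prime[3] prime[5] (λ ())
module Primes-2-3 = PrimePair prime[2] prime[3] (λ ())

4^*6^≡2^*3^ : ∀ e₁ e₂ → 4 ^ e₁ * 6 ^ e₂ ≡ 2 ^ (2 * e₁ + e₂) * 3 ^ e₂
4^*6^≡2^*3^ e₁ e₂ = begin
  4 ^ e₁ * 6 ^ e₂                  ≡⟨ cong₂ _*_ (^-*-assoc 2 2 e₁) (^-distrib-* 2 3 e₂) ⟩
  2 ^ (2 * e₁) * (2 ^ e₂ * 3 ^ e₂) ≡⟨ *-assoc (2 ^ (2 * e₁)) (2 ^ e₂) (3 ^ e₂) ⟨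
  2 ^ (2 * e₁) * 2 ^ e₂ * 3 ^ e₂   ≡⟨ cong (_* 3 ^ e₂) (^-distribˡ-+-* 2 (2 * e₁) e₂) ⟨
  2 ^ (2 * e₁ + e₂) * 3 ^ e₂       ∎
  where open ≡-Reasoning

independent-4-6 : Independent 4 6
independent-4-6 {e₁} {e₂} {f₁} {f₂} eq =
  let 2e₁+e₂≡2f₁+f₂ , e₂≡f₂ = Primes-2-3.smooth-unique
        (trans (sym (4^*6^≡2^*3^ e₁ e₂)) (trans eq (4^*6^≡2^*3^ f₁ f₂)))
  in  *-cancelˡ-≡ e₁ f₁ 2 (+-cancelʳ-≡ e₂ (2 * e₁) (2 * f₁)
        (trans 2e₁+e₂≡2f₁+f₂ (cong (_+_ (2 * f₁)) (sym e₂≡f₂)))) , e₂≡f₂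

multDep-3-5⇒smooth : ∀ m → MultDep (3 ∷ 5 ∷ suc m ∷ []) → Smooth 3 5 (suc m)
multDep-3-5⇒smooth m dep =
  Primes-3-5.smooth-of-multDepℕ Primes-3-5.smooth-unique (λ e₁ e₂ → e₁ , e₂ , refl)
    (suc m) (multDep⇒multDepℕ (2 ∷ 4 ∷ m ∷ []) dep)

multDep-4-6⇒smooth : ∀ m → MultDep (4 ∷ 6 ∷ suc m ∷ []) → Smooth 2 3 (suc m)
multDep-4-6⇒smooth m dep =
  Primes-2-3.smooth-of-multDepℕ independent-4-6 (λ e₁ e₂ → 2 * e₁ + e₂ , e₂ , 4^*6^≡2^*3^ e₁ e₂)
    (suc m) (multDep⇒multDepℕ (3 ∷ 5 ∷ m ∷ []) dep)

^-%-≡1 : ∀ {b M} .{{_ : NonZero M}} → b % M ≡ 1 % M → ∀ k → b ^ k % M ≡ 1 % M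
^-%-≡1         b≡1 zero    = refl
^-%-≡1 {b} {M} b≡1 (suc k) = begin
  b * b ^ k % M             ≡⟨ %-distribˡ-* b (b ^ k) M ⟩
  (b % M) * (b ^ k % M) % M ≡⟨ cong₂ (λ u v → u * v % M) b≡1 (^-%-≡1 b≡1 k) ⟩
  (1 % M) * (1 % M) % M     ≡⟨ %-distribˡ-* 1 1 M ⟨
  1 % M                     ∎
  where open ≡-Reasoning

^-%-periodic : ∀ {b d M} .{{_ : NonZero d}} .{{_ : NonZero M}} →
               b ^ d % M ≡ 1 % M → ∀ k → b ^ k % M ≡ b ^ (k % d) % M
^-%-periodic {b} {d} {M} b^d≡1 k = begin
  b ^ k % M                                      ≡⟨ cong (λ n → b ^ n % M) (m≡m%n+[m/n]*n k d) ⟩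
  b ^ (k % d + k / d * d) % M                    ≡⟨ cong (_% M) (^-distribˡ-+-* b (k % d) (k / d * d)) ⟩
  b ^ (k % d) * b ^ (k / d * d) % M              ≡⟨ %-distribˡ-* (b ^ (k % d)) (b ^ (k / d * d)) M ⟩
  (b ^ (k % d) % M) * (b ^ (k / d * d) % M) % M  ≡⟨ cong (λ v → (b ^ (k % d) % M) * v % M) b^[qd]≡1 ⟩
  (b ^ (k % d) % M) * (1 % M) % M                ≡⟨ %-distribˡ-* (b ^ (k % d)) 1 M ⟨
  b ^ (k % d) * 1 % M                            ≡⟨ cong (_% M) (*-identityʳ (b ^ (k % d))) ⟩
  b ^ (k % d) % M                                ∎
  where
  open ≡-Reasoning
  b^[qd]≡1 : b ^ (k / d * d) % M ≡ 1 % M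
  b^[qd]≡1 = begin
    b ^ (k / d * d) % M   ≡⟨ cong (λ n → b ^ n % M) (*-comm (k / d) d) ⟩
    b ^ (d * (k / d)) % M ≡⟨ cong (_% M) (^-*-assoc b d (k / d)) ⟨
    (b ^ d) ^ (k / d) % M ≡⟨ ^-%-≡1 b^d≡1 (k / d) ⟩
    1 % M                 ∎

^-+-%-invariant : ∀ {P : ℕ → Set} (P? : Decidable P) b a d M .{{_ : NonZero d}} .{{_ : NonZero M}} →
                  b ^ d % M ≡ 1 % M → {_ : True (allUpTo? (λ s → P? ((b ^ s + a) % M)) d)} →
                  ∀ k → P ((b ^ k + a) % M)
^-+-%-invariant {P} P? b a d M b^d≡1 {holds} k = subst P (sym reduce) (toWitness holds (m%n<n k d))
  where
  open ≡-Reasoning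
  reduce : (b ^ k + a) % M ≡ (b ^ (k % d) + a) % M
  reduce = begin
    (b ^ k + a) % M                   ≡⟨ %-distribˡ-+ (b ^ k) a M ⟩
    (b ^ k % M + a % M) % M           ≡⟨ cong (λ t → (t + a % M) % M) (^-%-periodic {b} {d} {M} b^d≡1 k) ⟩
    (b ^ (k % d) % M + a % M) % M     ≡⟨ %-distribˡ-+ (b ^ (k % d)) a M ⟨
    (b ^ (k % d) + a) % M             ∎

-- n ≡ m - 1 (mod M + 1), stated without truncated subtraction.
+1≡⇒%≡ : ∀ {n m} M → n + 1 ≡ m → n % suc M ≡ (m + M) % suc M
+1≡⇒%≡ {n} {m} M n+1≡m = begin
  n % suc M               ≡⟨ [m+n]%n≡m%n n (suc M) ⟨
  (n + suc M) % suc M     ≡⟨ cong (_% suc M) (+-assoc n 1 M) ⟨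
  (n + 1 + M) % suc M     ≡⟨ cong (λ k → (k + M) % suc M) n+1≡m ⟩
  (m + M) % suc M         ∎
  where open ≡-Reasoning

-- 2 has order 6 modulo 63 = 9 · 7, and 2^s ≡ 1 (mod 9) only for s ≡ 0 (mod 6).
n+1≡2^u⇒9∣n⇒7∣n : ∀ {n} u → n + 1 ≡ 2 ^ u → 9 ∣ n → 7 ∣ n
n+1≡2^u⇒9∣n⇒7∣n {n} u n+1≡2^u 9∣n =
  ∣n∣m%n⇒∣m (divides 9 refl) (subst (7 ∣_) (sym n%63) (residue 9∣residue))
  where
  n%63 : n % 63 ≡ (2 ^ u + 62) % 63
  n%63 = +1≡⇒%≡ 62 n+1≡2^u
  9∣residue : 9 ∣ (2 ^ u + 62) % 63
  9∣residue = subst (9 ∣_) n%63 (%-presˡ-∣ 9∣n (divides 7 refl))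
  residue : 9 ∣ (2 ^ u + 62) % 63 → 7 ∣ (2 ^ u + 62) % 63
  residue = ^-+-%-invariant (λ t → 9 ∣? t →-dec 7 ∣? t) 2 62 6 63 refl u

-- 2 has order 20 modulo 275 = 25 · 11, and 2^s ≡ 1 (mod 25) only for s ≡ 0 (mod 20).
n+1≡2^u⇒25∣n⇒11∣n : ∀ {n} u → n + 1 ≡ 2 ^ u → 25 ∣ n → 11 ∣ n
n+1≡2^u⇒25∣n⇒11∣n {n} u n+1≡2^u 25∣n =
  ∣n∣m%n⇒∣m (divides 25 refl) (subst (11 ∣_) (sym n%275) (residue 25∣residue))
  where
  n%275 : n % 275 ≡ (2 ^ u + 274) % 275
  n%275 = +1≡⇒%≡ 274 n+1≡2^u
  25∣residue : 25 ∣ (2 ^ u + 274) % 275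
  25∣residue = subst (25 ∣_) n%275 (%-presˡ-∣ 25∣n (divides 11 refl))
  residue : 25 ∣ (2 ^ u + 274) % 275 → 11 ∣ (2 ^ u + 274) % 275
  residue = ^-+-%-invariant (λ t → 25 ∣? t →-dec 11 ∣? t) 2 274 20 275 refl u

-- 5 has order 6 modulo 63; 5^s ≡ -1 (mod 9) only for s ≡ 3 (mod 6), and 5^3 ≡ -1 (mod 7).
9∣5^y+1⇒7∣5^y+1 : ∀ y → 9 ∣ 5 ^ y + 1 → 7 ∣ 5 ^ y + 1
9∣5^y+1⇒7∣5^y+1 y 9∣n = ∣n∣m%n⇒∣m (divides 9 refl) (residue (%-presˡ-∣ 9∣n (divides 7 refl)))
  where residue = ^-+-%-invariant (λ t → 9 ∣? t →-dec 7 ∣? t) 5 1 6 63 refl y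

4∤5^y+1 : ∀ y → 4 ∤ 5 ^ y + 1
4∤5^y+1 y 4∣n = ^-+-%-invariant (λ t → ¬? (4 ∣? t)) 5 1 1 4 refl y (%-presˡ-∣ 4∣n ∣-refl)

2∣5^y+1 : ∀ y → 2 ∣ 5 ^ y + 1
2∣5^y+1 y = ∣n∣m%n⇒∣m ∣-refl (^-+-%-invariant (2 ∣?_) 5 1 1 2 refl y)

-- The equation 3^x 5^y + 1 = 2^u 3^v

9∣3^[2+x] : ∀ x → 9 ∣ 3 ^ (2 + x)
9∣3^[2+x] x = subst (9 ∣_) (*-assoc 3 3 (3 ^ x)) (m∣m*n (3 ^ x))

5^y+1≡2^u*3^[1+v]⇒y≤1 : ∀ y u v → 5 ^ y + 1 ≡ 2 ^ u * 3 ^ suc v → y ≤ 1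
5^y+1≡2^u*3^[1+v]⇒y≤1 y zero v eq =
  contradiction (subst (2 ∣_) (trans eq (*-identityˡ (3 ^ suc v))) (2∣5^y+1 y))
                (prime∤^ prime[2] (from-no (2 ∣? 3)) (suc v))
5^y+1≡2^u*3^[1+v]⇒y≤1 y (2+ u) v eq =
  contradiction (subst (4 ∣_) (sym eq) (∣m⇒∣m*n (3 ^ suc v) 4∣2^[2+u])) (4∤5^y+1 y)
  where
  4∣2^[2+u] : 4 ∣ 2 ^ (2 + u)
  4∣2^[2+u] = subst (4 ∣_) (*-assoc 2 2 (2 ^ u)) (m∣m*n (2 ^ u))
5^y+1≡2^u*3^[1+v]⇒y≤1 y 1 (suc v) eq =
  contradiction (subst (7 ∣_) eq (9∣5^y+1⇒7∣5^y+1 y (subst (9 ∣_) (sym eq) 9∣2*3^[2+v])))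
                (prime∤^*^ prime[7] (from-no (7 ∣? 2)) (from-no (7 ∣? 3)) 1 (2 + v))
  where
  9∣2*3^[2+v] : 9 ∣ 2 ^ 1 * 3 ^ (2 + v)
  9∣2*3^[2+v] = ∣n⇒∣m*n 2 (9∣3^[2+x] v)
5^y+1≡2^u*3^[1+v]⇒y≤1 y 1 zero eq =
  ≤-reflexive (^-injectiveʳ {5} {y} {1} (s≤s (s≤s z≤n)) (+-cancelʳ-≡ 1 (5 ^ y) 5 eq))

3^x*5^y+1≡2^u*3^v⇒x,y≤1 : ∀ x y u v → 3 ^ x * 5 ^ y + 1 ≡ 2 ^ u * 3 ^ v → x ≤ 1 × y ≤ 1
3^x*5^y+1≡2^u*3^v⇒x,y≤1 (suc x) y u (suc v) eq =
  contradiction (∣m+n∣m⇒∣n 3∣n+1 3∣n) (prime∤1 prime[3])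
  where
  3∣n : 3 ∣ 3 ^ suc x * 5 ^ y
  3∣n = ∣m⇒∣m*n (5 ^ y) (m∣m*n (3 ^ x))
  3∣n+1 : 3 ∣ 3 ^ suc x * 5 ^ y + 1
  3∣n+1 = subst (3 ∣_) (sym eq) (∣n⇒∣m*n (2 ^ u) (m∣m*n (3 ^ v)))
3^x*5^y+1≡2^u*3^v⇒x,y≤1 (2+ x) y u zero eq =
  contradiction (n+1≡2^u⇒9∣n⇒7∣n u (trans eq (*-identityʳ (2 ^ u))) (∣m⇒∣m*n (5 ^ y) (9∣3^[2+x] x)))
                (prime∤^*^ prime[7] (from-no (7 ∣? 3)) (from-no (7 ∣? 5)) (2 + x) y)
3^x*5^y+1≡2^u*3^v⇒x,y≤1 x (2+ y) u zero eq =
  contradiction (n+1≡2^u⇒25∣n⇒11∣n u (trans eq (*-identityʳ (2 ^ u))) (∣n⇒∣m*n (3 ^ x) 25∣5^[2+y]))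
                (prime∤^*^ prime[11] (from-no (11 ∣? 3)) (from-no (11 ∣? 5)) x (2 + y))
  where
  25∣5^[2+y] : 25 ∣ 5 ^ (2 + y)
  25∣5^[2+y] = subst (25 ∣_) (*-assoc 5 5 (5 ^ y)) (m∣m*n (5 ^ y))
3^x*5^y+1≡2^u*3^v⇒x,y≤1 0 0 u zero _ = z≤n , z≤n
3^x*5^y+1≡2^u*3^v⇒x,y≤1 0 1 u zero _ = z≤n , ≤-refl
3^x*5^y+1≡2^u*3^v⇒x,y≤1 1 0 u zero _ = ≤-refl , z≤n
3^x*5^y+1≡2^u*3^v⇒x,y≤1 1 1 u zero _ = ≤-refl , ≤-refl
3^x*5^y+1≡2^u*3^v⇒x,y≤1 zero y u (suc v) eq =
  z≤n , 5^y+1≡2^u*3^[1+v]⇒y≤1 y u v (trans (cong (_+ 1) (sym (*-identityˡ (5 ^ y)))) eq)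

c+1≡3^x*5^y⇒c≡14 : ∀ {c x y} → 3 ≤ c → c ≢ 4 → x ≤ 1 → y ≤ 1 →
                    c + 1 ≡ 3 ^ x * 5 ^ y → c ≡ 14
c+1≡3^x*5^y⇒c≡14 {c} 3≤c c≢4 z≤n       z≤n       eq with refl ← +-cancelʳ-≡ 1 c 0 eq =
  contradiction 3≤c (from-no (3 ≤? 0))
c+1≡3^x*5^y⇒c≡14 {c} 3≤c c≢4 z≤n       (s≤s z≤n) eq =
  contradiction (+-cancelʳ-≡ 1 c 4 eq) c≢4
c+1≡3^x*5^y⇒c≡14 {c} 3≤c c≢4 (s≤s z≤n) z≤n       eq with refl ← +-cancelʳ-≡ 1 c 2 eq =
  contradiction 3≤c (from-no (3 ≤? 2))
c+1≡3^x*5^y⇒c≡14 {c} 3≤c c≢4 (s≤s z≤n) (s≤s z≤n) eq =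
  +-cancelʳ-≡ 1 c 14 eq

lemma5 : (c : ℕ) → 3 ≤ c → ¬ (c ≡ 4)
         → (MultDep (2 ∷ 4 ∷ c ∷ [])
              × MultDep (3 ∷ 5 ∷ (c + 1) ∷ [])
              × MultDep (4 ∷ 6 ∷ (c + 2) ∷ []))
           ⇔ (c ≡ 14)
lemma5 c@(suc m) 3≤c c≢4 = mk⇔ (λ (_ , dep₁ , dep₂) → only-14 dep₁ dep₂) dependent-at-14
  where
  only-14 : MultDep (3 ∷ 5 ∷ (c + 1) ∷ []) → MultDep (4 ∷ 6 ∷ (c + 2) ∷ []) → c ≡ 14
  only-14 dep₁ dep₂ =
    let x , y , c+1≡3^x*5^y = multDep-3-5⇒smooth (m + 1) dep₁
        u , v , c+2≡2^u*3^v = multDep-4-6⇒smooth (m + 2) dep₂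
        x≤1 , y≤1 = 3^x*5^y+1≡2^u*3^v⇒x,y≤1 x y u v
                      (trans (cong (_+ 1) (sym c+1≡3^x*5^y)) (trans (+-assoc c 1 1) c+2≡2^u*3^v))
    in  c+1≡3^x*5^y⇒c≡14 3≤c c≢4 x≤1 y≤1 c+1≡3^x*5^y

  dependent-at-14 : c ≡ 14 → MultDep (2 ∷ 4 ∷ c ∷ [])
                               × MultDep (3 ∷ 5 ∷ (c + 1) ∷ [])
                               × MultDep (4 ∷ 6 ∷ (c + 2) ∷ [])
  dependent-at-14 refl = (+ 2 ∷ -[1+ 0 ] ∷ + 0 ∷ [] , here (λ ()) , refl)
                       , (+ 1 ∷ + 1 ∷ -[1+ 0 ] ∷ [] , here (λ ()) , refl)
                       , (+ 2 ∷ + 0 ∷ -[1+ 0 ] ∷ [] , here (λ ()) , refl)
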